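{- If $G$ is a graph with girth $g(G)\ge 7$ and no isolated vertices, then $\theta(G^{[\natural 2]})=\chi_{i\mu_2}(G)=\gamma_t(G)$.
   Context: All graphs are finite, simple and undirected. The girth is the length of a shortest cycle ($\infty$ for forests). A $u,v$-geodesic is a shortest $u,v$-path. A set $M\subseteq V(G)$ is a $2$-distance mutual-visibility set if for every two distinct $u,v\in M$ there is a $u,v$-geodesic of length at most $2$ none of whose internal vertices lies in $M$. A set is an independent $2$-distance mutual-visibility set if it is both independent and a $2$-distance mutual-visibility set; $\chi_{i\mu_2}(G)$ is the minimum number of parts in a partition of $V(G)$ into independent $2$-distance mutual-visibility sets. The exact distance-$2$ graph $G^{[\natural 2]}$ has vertex set $V(G)$, two vertices being adjacent iff their distance in $G$ equals $2$. $\theta(X)$ denotes the clique cover number of a graph $X$: the minimum number of cliques partitioning $V(X)$. $\gamma_t(G)$ is the total domination number: the minimum size of a set $D\subseteq V(G)$ such that every vertex of $G$ has a neighbor in $D$. -}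

module Defs where

open import Data.Nat using (ℕ; zero; suc; _≤_; _<_)
open import Data.Fin using (Fin; zero; suc; fromℕ; inject₁)
open import Data.Fin.Subset using (Subset; _∈_; ∣_∣)
open import Data.Product using (Σ; _×_; ∃; ∃-syntax)
open import Data.Empty using (⊥)
open import Relation.Nullary using (¬_)
open import Relation.Binary using (Decidable)
open import Relation.Binary.PropositionalEquality using (_≡_; _≢_)
open import Function.Definitions using (Injective)

record Graph (n : ℕ) : Set₁ where
  field
    Adj     : Fin n → Fin n → Set
    adj?    : Decidable Adj
    sym     : ∀ {u v} → Adj u v → Adj v u
    irrefl  : ∀ {v} → ¬ Adj v v

module _ {n : ℕ} (G : Graph n) where
  open Graph G

  Walk : Fin n → Fin n → ℕ → Set
  Walk u v k = Σ (Fin (suc k) → Fin n) λ f →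
    (f zero ≡ u) × (f (fromℕ k) ≡ v) × (∀ (i : Fin k) → Adj (f (inject₁ i)) (f (suc i)))

  Dist : Fin n → Fin n → ℕ → Set
  Dist u v k = Walk u v k × (∀ j → j < k → ¬ Walk u v j)

  IsGeodesic : Fin n → Fin n → (k : ℕ) → (Fin (suc k) → Fin n) → Set
  IsGeodesic u v k f =
    (f zero ≡ u) × (f (fromℕ k) ≡ v) × (∀ (i : Fin k) → Adj (f (inject₁ i)) (f (suc i)))
    × (∀ j → j < k → ¬ Walk u v j)

  -- cycle with k vertices (k ≥ 3 is imposed where used)
  Cycle : ℕ → Set
  Cycle zero    = ⊥
  Cycle (suc m) = Σ (Fin (suc m) → Fin n) λ f → Injective _≡_ _≡_ f
    × (∀ (i : Fin m) → Adj (f (inject₁ i)) (f (suc i)))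
    × Adj (f (fromℕ m)) (f zero)

  GirthAtLeast : ℕ → Set
  GirthAtLeast g = ∀ k → 3 ≤ k → k < g → ¬ Cycle k

  NoIsolatedVertices : Set
  NoIsolatedVertices = ∀ v → ∃[ u ] Adj v u

  Adj♮2 : Fin n → Fin n → Set
  Adj♮2 u v = Dist u v 2

  Independent : (Fin n → Set) → Set
  Independent M = ∀ u v → M u → M v → ¬ Adj u v

  MutVis2 : (Fin n → Set) → Set
  MutVis2 M = ∀ u v → M u → M v → u ≢ v →
    Σ ℕ λ k → (k ≤ 2) × Σ (Fin (suc k) → Fin n) λ f → IsGeodesic u v k f
      × (∀ (i : Fin (suc k)) → i ≢ zero → i ≢ fromℕ k → ¬ M (f i))

  -- partition of V(G) into at most k independent 2-distance mutual-visibility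
  -- sets, given as a colouring c (colour classes are the parts).
  HasIMV2Partition : ℕ → Set
  HasIMV2Partition k = Σ (Fin n → Fin k) λ c → ∀ (j : Fin k) →
    Independent (λ v → c v ≡ j) × MutVis2 (λ v → c v ≡ j)

  HasCliqueCover♮2 : ℕ → Set
  HasCliqueCover♮2 k = Σ (Fin n → Fin k) λ c → ∀ (j : Fin k) →
    ∀ u v → c u ≡ j → c v ≡ j → u ≢ v → Adj♮2 u v

  HasTDS : ℕ → Set
  HasTDS k = Σ (Subset n) λ D → (∣ D ∣ ≡ k) × (∀ v → ∃[ u ] (u ∈ D × Adj v u))

IsMinimum : (ℕ → Set) → ℕ → Set
IsMinimum P m = P m × (∀ k → P k → m ≤ k)

{-# OPTIONS --safe #-}
-- In a triangle-free graph two distinct vertices with a common neighbour are at distance 2.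
-- Conversely, if the girth is at least 7, a set of pairwise distance-2 vertices has a common
-- neighbour: three of them with no common neighbour would close a cycle of length 4 or 6.
-- So clique covers of G^[♮2] by k cliques are the same as k-colourings whose classes lie in
-- open neighbourhoods, and the centres of such a colouring form a total dominating set of size
-- at most k; conversely each vertex can be coloured by a dominator adjacent to it.
-- Finally, a clique of G^[♮2] is exactly an independent 2-distance mutual-visibility set, because
-- the middle vertex of a geodesic of length 2 is adjacent to its ends.
module Submission where

open import Defs
open import Data.Nat using (ℕ; zero; suc; _≤_; _<_; _+_; z≤n; s≤s)
open import Data.Nat.Properties
  using (≤-refl; ≤-trans; ≤-reflexive; ≮⇒≥; m<1+n⇒m<n∨m≡n; m≤m+n; n≤1+n; +-suc; +-monoʳ-≤; +-mono-≤)
  renaming (_≟_ to _≟ℕ_)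
open import Data.Fin using (Fin; zero; suc; fromℕ; inject₁; _≟_)
open import Data.Fin.Properties using (any?; all?)
open import Data.Fin.Subset using (Subset; _∈_; ∣_∣; inside; outside; ⁅_⁆; _∪_; ⊤; ⊥)
open import Data.Fin.Subset.Properties using (_∈?_; anySubset?; x∈⁅x⁆; x∈p∪q⁺; ∣⁅x⁆∣≡1; ∣⊥∣≡0; ∈⊤; ∣⊤∣≡n)
open import Data.Vec using (Vec; []; _∷_; here; there; lookup)
open import Data.Vec.Relation.Unary.All using ([]; _∷_)
open import Data.Vec.Relation.Unary.AllPairs using ([]; _∷_)
open import Data.Vec.Relation.Unary.Unique.Propositional using (Unique)
open import Data.Vec.Relation.Unary.Unique.Propositional.Properties using (lookup-injective)
open import Data.Product using (Σ; _×_; _,_; proj₁; proj₂; ∃; ∃-syntax)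
open import Data.Sum using (_⊎_; inj₁; inj₂)
open import Relation.Nullary using (¬_; Dec; yes; no; contradiction)
open import Relation.Nullary.Decidable using (_×-dec_; ¬?)
open import Relation.Unary using (Pred) renaming (Decidable to Decidable₁)
open import Relation.Binary.PropositionalEquality using (_≡_; _≢_; refl; sym; trans; cong; subst; ≢-sym)
open import Level using (0ℓ)

private variable
  n : ℕ

module _ {P : ℕ → Set} (P? : Decidable₁ P) where

  minimum-below : ∀ b → (∀ k → k < b → ¬ P k) ⊎ ∃ (IsMinimum P)
  minimum-below zero = inj₁ (λ _ ())
  minimum-below (suc b) with minimum-below b
  ... | inj₂ min = inj₂ min
  ... | inj₁ none with P? b
  ...   | yes pb = inj₂ (b , pb , λ k pk → ≮⇒≥ (λ k<b → none k k<b pk))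
  ...   | no ¬pb = inj₁ below-suc
    where
    below-suc : ∀ k → k < suc b → ¬ P k
    below-suc k k<1+b with m<1+n⇒m<n∨m≡n k<1+b
    ... | inj₁ k<b = none k k<b
    ... | inj₂ refl = ¬pb

  minimum : ∀ {k} → P k → ∃ (IsMinimum P)
  minimum {k} pk with minimum-below (suc k)
  ... | inj₁ none = contradiction pk (none k ≤-refl)
  ... | inj₂ min = min

IsMinimum-transfer : ∀ {P Q : ℕ → Set} {m} → IsMinimum P m → Q m →
  (∀ k → Q k → ∃[ s ] P s × s ≤ k) → IsMinimum Q m
IsMinimum-transfer (_ , P-min) qm Q⇒P = qm , λ k qk →
  let s , ps , s≤k = Q⇒P k qk in ≤-trans (P-min s ps) s≤k

index : (p : Subset n) {x : Fin n} → x ∈ p → Fin ∣ p ∣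
index (inside ∷ p) here = zero
index (inside ∷ p) (there x∈p) = suc (index p x∈p)
index (outside ∷ p) (there x∈p) = index p x∈p

member : (p : Subset n) → Fin ∣ p ∣ → Fin n
member (inside ∷ p) zero = zero
member (inside ∷ p) (suc i) = suc (member p i)
member (outside ∷ p) i = suc (member p i)

member-index : (p : Subset n) {x : Fin n} (x∈p : x ∈ p) → member p (index p x∈p) ≡ x
member-index (inside ∷ p) here = refl
member-index (inside ∷ p) (there x∈p) = cong suc (member-index p x∈p)
member-index (outside ∷ p) (there x∈p) = cong suc (member-index p x∈p)

∣p∪q∣≤∣p∣+∣q∣ : (p q : Subset n) → ∣ p ∪ q ∣ ≤ ∣ p ∣ + ∣ q ∣
∣p∪q∣≤∣p∣+∣q∣ [] [] = z≤n
∣p∪q∣≤∣p∣+∣q∣ (inside ∷ p) (inside ∷ q) = s≤s (≤-trans (∣p∪q∣≤∣p∣+∣q∣ p q) (+-monoʳ-≤ ∣ p ∣ (n≤1+n _)))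
∣p∪q∣≤∣p∣+∣q∣ (inside ∷ p) (outside ∷ q) = s≤s (∣p∪q∣≤∣p∣+∣q∣ p q)
∣p∪q∣≤∣p∣+∣q∣ (outside ∷ p) (inside ∷ q) = ≤-trans (s≤s (∣p∪q∣≤∣p∣+∣q∣ p q)) (≤-reflexive (sym (+-suc ∣ p ∣ ∣ q ∣)))
∣p∪q∣≤∣p∣+∣q∣ (outside ∷ p) (outside ∷ q) = ∣p∪q∣≤∣p∣+∣q∣ p q

image : ∀ {k} → (Fin k → Fin n) → Subset n
image {k = zero} f = ⊥
image {k = suc k} f = ⁅ f zero ⁆ ∪ image (λ j → f (suc j))

∣image∣≤ : ∀ {k} (f : Fin k → Fin n) → ∣ image f ∣ ≤ k
∣image∣≤ {n} {zero} f = ≤-reflexive (∣⊥∣≡0 n)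
∣image∣≤ {k = suc k} f = ≤-trans (∣p∪q∣≤∣p∣+∣q∣ ⁅ f zero ⁆ (image (λ j → f (suc j))))
  (+-mono-≤ (≤-reflexive (∣⁅x⁆∣≡1 (f zero))) (∣image∣≤ (λ j → f (suc j))))

∈image : ∀ {k} (f : Fin k → Fin n) j → f j ∈ image f
∈image f zero = x∈p∪q⁺ (inj₁ (x∈⁅x⁆ (f zero)))
∈image f (suc j) = x∈p∪q⁺ {p = ⁅ f zero ⁆} (inj₂ (∈image (λ j → f (suc j)) j))

module _ {n : ℕ} (G : Graph n) where
  open Graph G renaming (sym to Adj-sym)

  private variable
    u v w a b c x y : Fin n

  Adj⇒≢ : Adj x y → x ≢ y
  Adj⇒≢ xy refl = irrefl xy

  walk₀⇒≡ : Walk G x y 0 → x ≡ y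
  walk₀⇒≡ (_ , f₀≡x , f₀≡y , _) = trans (sym f₀≡x) f₀≡y

  walk₀ : Walk G x x 0
  walk₀ {x} = (λ _ → x) , refl , refl , λ ()

  walk₁⇒Adj : Walk G x y 1 → Adj x y
  walk₁⇒Adj (f , refl , refl , step) = step zero

  walk₁ : Adj x y → Walk G x y 1
  walk₁ {x} {y} xy = (λ { zero → x ; (suc zero) → y }) , refl , refl , λ { zero → xy }

  walk₂ : Adj x a → Adj a y → Walk G x y 2
  walk₂ {x} {a} {y} xa ay =
    (λ { zero → x ; (suc zero) → a ; (suc (suc zero)) → y }) , refl , refl , λ { zero → xa ; (suc zero) → ay }

  Adj♮2⇒≢ : Adj♮2 G x y → x ≢ y
  Adj♮2⇒≢ (_ , shortest) refl = shortest 0 (s≤s z≤n) walk₀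

  Adj♮2⇒¬Adj : Adj♮2 G x y → ¬ Adj x y
  Adj♮2⇒¬Adj (_ , shortest) xy = shortest 1 (s≤s (s≤s z≤n)) (walk₁ xy)

  Adj♮2⇒commonNeighbour : Adj♮2 G x y → ∃[ a ] Adj x a × Adj a y
  Adj♮2⇒commonNeighbour ((f , refl , refl , step) , _) = f (suc zero) , step zero , step (suc zero)

  GirthAtLeast-mono : ∀ {g h} → g ≤ h → GirthAtLeast G h → GirthAtLeast G g
  GirthAtLeast-mono g≤h girth k 3≤k k<g = girth k 3≤k (≤-trans k<g g≤h)

  cycle : ∀ {m} (xs : Vec (Fin n) (suc m)) → Unique xs →
    (∀ i → Adj (lookup xs (inject₁ i)) (lookup xs (suc i))) → Adj (lookup xs (fromℕ m)) (lookup xs zero) →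
    Cycle G (suc m)
  cycle xs distinct path closing = lookup xs , lookup-injective distinct _ _ , path , closing

  3≤3+ : ∀ {m} → 3 ≤ 3 + m
  3≤3+ = s≤s (s≤s (s≤s z≤n))

  triangle-free : GirthAtLeast G 4 → Adj a b → Adj b c → ¬ Adj c a
  triangle-free girth ab bc ca = girth 3 3≤3+ ≤-refl
    (cycle (_ ∷ _ ∷ _ ∷ [])
      ((Adj⇒≢ ab ∷ ≢-sym (Adj⇒≢ ca) ∷ []) ∷ (Adj⇒≢ bc ∷ []) ∷ [] ∷ [])
      (λ { zero → ab ; (suc zero) → bc }) ca)

  commonNeighbour-unique : GirthAtLeast G 5 → u ≢ v → Adj u a → Adj a v → Adj u b → Adj b v → a ≡ b
  commonNeighbour-unique {a = a} {b = b} girth u≢v ua av ub bv with a ≟ b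
  ... | yes a≡b = a≡b
  ... | no a≢b = contradiction
    (cycle (_ ∷ _ ∷ _ ∷ _ ∷ [])
      ((Adj⇒≢ ua ∷ u≢v ∷ Adj⇒≢ ub ∷ []) ∷ (Adj⇒≢ av ∷ a≢b ∷ []) ∷ (≢-sym (Adj⇒≢ bv) ∷ []) ∷ [] ∷ [])
      (λ { zero → ua ; (suc zero) → av ; (suc (suc zero)) → Adj-sym bv }) (Adj-sym ub))
    (girth 4 3≤3+ ≤-refl)

  commonNeighbour⇒Adj♮2 : GirthAtLeast G 4 → x ≢ y → Adj x a → Adj a y → Adj♮2 G x y
  commonNeighbour⇒Adj♮2 girth x≢y xa ay = walk₂ xa ay , shorter
    where
    shorter : ∀ j → j < 2 → ¬ Walk G _ _ j
    shorter zero _ walk = x≢y (walk₀⇒≡ walk)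
    shorter (suc zero) _ walk = triangle-free girth xa ay (Adj-sym (walk₁⇒Adj walk))
    shorter (suc (suc j)) (s≤s (s≤s ()))

  -- With b, c middle vertices of u-v and u-w: unless a ∈ {b, c}, u-b-v-a-w-c-u is a hexagon
  -- (b = c would give v and w two common neighbours).
  Adj♮2-triple-shares-neighbour : GirthAtLeast G 7 → Adj♮2 G u v → Adj♮2 G u w → Adj♮2 G v w →
    Adj v a → Adj a w → Adj u a
  Adj♮2-triple-shares-neighbour {u} {v} {w} {a} girth uv uw vw va aw
    with Adj♮2⇒commonNeighbour uv | Adj♮2⇒commonNeighbour uw
  ... | b , ub , bv | c , uc , cw with a ≟ b | a ≟ c | b ≟ c
  ... | yes refl | _ | _ = ub
  ... | no _ | yes refl | _ = uc
  ... | no a≢b | no _ | yes refl =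
    contradiction (commonNeighbour-unique (GirthAtLeast-mono (m≤m+n 5 2) girth) (Adj♮2⇒≢ vw) va aw (Adj-sym bv) cw) a≢b
  ... | no a≢b | no a≢c | no b≢c = contradiction
    (cycle (u ∷ b ∷ v ∷ a ∷ w ∷ c ∷ [])
      ((Adj⇒≢ ub ∷ Adj♮2⇒≢ uv ∷ u≢a ∷ Adj♮2⇒≢ uw ∷ Adj⇒≢ uc ∷ [])
      ∷ (Adj⇒≢ bv ∷ ≢-sym a≢b ∷ b≢w ∷ b≢c ∷ [])
      ∷ (Adj⇒≢ va ∷ Adj♮2⇒≢ vw ∷ v≢c ∷ [])
      ∷ (Adj⇒≢ aw ∷ a≢c ∷ [])
      ∷ (≢-sym (Adj⇒≢ cw) ∷ [])
      ∷ [] ∷ [])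
      (λ { zero → ub ; (suc zero) → bv ; (suc (suc zero)) → va ; (suc (suc (suc zero))) → aw
         ; (suc (suc (suc (suc zero)))) → Adj-sym cw })
      (Adj-sym uc))
    (girth 6 3≤3+ ≤-refl)
    where
    u≢a : u ≢ a
    u≢a refl = Adj♮2⇒¬Adj uv (Adj-sym va)
    b≢w : b ≢ w
    b≢w refl = Adj♮2⇒¬Adj uw ub
    v≢c : v ≢ c
    v≢c refl = Adj♮2⇒¬Adj uv uc

  IsClique♮2 : Pred (Fin n) 0ℓ → Set
  IsClique♮2 M = ∀ u v → M u → M v → u ≢ v → Adj♮2 G u v

  clique♮2-commonNeighbour : GirthAtLeast G 7 → NoIsolatedVertices G → {M : Pred (Fin n) 0ℓ} →
    Decidable₁ M → IsClique♮2 M → M v → ∃[ a ] (∀ u → M u → Adj u a)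
  clique♮2-commonNeighbour {v} girth noIsolated {M} M? clique v∈M
    with any? (λ w → M? w ×-dec ¬? (w ≟ v))
  ... | no singleton = proj₁ (noIsolated v) , only-v
    where
    only-v : ∀ u → M u → Adj u (proj₁ (noIsolated v))
    only-v u u∈M with u ≟ v
    ... | yes refl = proj₂ (noIsolated v)
    ... | no u≢v = contradiction (u , u∈M , u≢v) singleton
  ... | yes (w , w∈M , w≢v) with Adj♮2⇒commonNeighbour (clique v w v∈M w∈M (≢-sym w≢v))
  ...   | a , va , aw = a , adjacent
    where
    adjacent : ∀ u → M u → Adj u a
    adjacent u u∈M with u ≟ v | u ≟ w
    ... | yes refl | _ = va
    ... | no _ | yes refl = Adj-sym aw
    ... | no u≢v | no u≢w = Adj♮2-triple-shares-neighbour girth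
      (clique u v u∈M v∈M u≢v) (clique u w u∈M w∈M u≢w) (clique v w v∈M w∈M (≢-sym w≢v)) va aw

  HasNeighbourhoodPartition : ℕ → Set
  HasNeighbourhoodPartition k =
    Σ (Fin n → Fin k) λ c → Σ (Fin k → Fin n) λ centre → ∀ v → Adj v (centre (c v))

  TDS⇒neighbourhoodPartition : ∀ {k} → HasTDS G k → HasNeighbourhoodPartition k
  TDS⇒neighbourhoodPartition (D , refl , dominates) =
    (λ v → index D (proj₁ (proj₂ (dominates v)))) , member D , λ v →
      let d , d∈D , vd = dominates v in subst (Adj v) (sym (member-index D d∈D)) vd

  neighbourhoodPartition⇒TDS : ∀ {k} → HasNeighbourhoodPartition k → ∃[ s ] HasTDS G s × s ≤ k
  neighbourhoodPartition⇒TDS (c , centre , adjacent) =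
    ∣ image centre ∣ , (image centre , refl , λ v → centre (c v) , ∈image centre (c v) , adjacent v) ,
    ∣image∣≤ centre

  neighbourhoodPartition⇒cliqueCover : GirthAtLeast G 4 → ∀ {k} → HasNeighbourhoodPartition k → HasCliqueCover♮2 G k
  neighbourhoodPartition⇒cliqueCover girth (c , centre , adjacent) = c , λ { j u v refl cv≡cu u≢v →
    commonNeighbour⇒Adj♮2 girth u≢v (adjacent u) (subst (λ i → Adj (centre i) v) cv≡cu (Adj-sym (adjacent v))) }

  -- z is the junk centre of empty colour classes.
  cliqueCover⇒neighbourhoodPartition : GirthAtLeast G 7 → NoIsolatedVertices G → Fin n →
    ∀ {k} → HasCliqueCover♮2 G k → HasNeighbourhoodPartition k
  cliqueCover⇒neighbourhoodPartition girth noIsolated z (c , clique) =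
    c , (λ j → proj₁ (centre j)) , λ v → proj₂ (centre (c v)) v refl
    where
    centre : ∀ j → ∃[ a ] (∀ u → c u ≡ j → Adj u a)
    centre j with any? (λ v → c v ≟ j)
    ... | yes (v , cv≡j) = clique♮2-commonNeighbour girth noIsolated (λ u → c u ≟ j) (clique j) cv≡j
    ... | no empty = z , λ u cu≡j → contradiction (u , cu≡j) empty

  clique♮2⇒independent : {M : Pred (Fin n) 0ℓ} → IsClique♮2 M → Independent G M
  clique♮2⇒independent clique u v u∈M v∈M uv = Adj♮2⇒¬Adj (clique u v u∈M v∈M (Adj⇒≢ uv)) uv

  clique♮2⇒mutVis2 : {M : Pred (Fin n) 0ℓ} → IsClique♮2 M → MutVis2 G M
  clique♮2⇒mutVis2 {M} clique u v u∈M v∈M u≢v with clique u v u∈M v∈M u≢v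
  ... | (f , refl , refl , step) , shortest = 2 , ≤-refl , f , (refl , refl , step , shortest) , interior-outside
    where
    interior-outside : ∀ i → i ≢ zero → i ≢ fromℕ 2 → ¬ M (f i)
    interior-outside zero i≢0 _ = contradiction refl i≢0
    interior-outside (suc zero) _ _ f₁∈M = clique♮2⇒independent clique (f zero) (f (suc zero)) u∈M f₁∈M (step zero)
    interior-outside (suc (suc zero)) _ i≢2 = contradiction refl i≢2

  independent-mutVis2⇒clique♮2 : {M : Pred (Fin n) 0ℓ} → Independent G M → MutVis2 G M → IsClique♮2 M
  independent-mutVis2⇒clique♮2 independent visible u v u∈M v∈M u≢v with visible u v u∈M v∈M u≢v
  ... | zero , _ , f , (f₀≡u , f₀≡v , _ , _) , _ = contradiction (trans (sym f₀≡u) f₀≡v) u≢v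
  ... | suc zero , _ , f , (f₀≡u , f₁≡v , step , _) , _ =
    contradiction (walk₁⇒Adj (f , f₀≡u , f₁≡v , step)) (independent u v u∈M v∈M)
  ... | suc (suc zero) , _ , f , (f₀≡u , f₂≡v , step , shortest) , _ = (f , f₀≡u , f₂≡v , step) , shortest
  ... | suc (suc (suc _)) , s≤s (s≤s ()) , _

  cliqueCover⇒IMV2Partition : ∀ {k} → HasCliqueCover♮2 G k → HasIMV2Partition G k
  cliqueCover⇒IMV2Partition (c , clique) = c , λ j → clique♮2⇒independent (clique j) , clique♮2⇒mutVis2 (clique j)

  IMV2Partition⇒cliqueCover : ∀ {k} → HasIMV2Partition G k → HasCliqueCover♮2 G k
  IMV2Partition⇒cliqueCover (c , parts) = c , λ j → independent-mutVis2⇒clique♮2 (proj₁ (parts j)) (proj₂ (parts j))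

  HasTDS? : ∀ k → Dec (HasTDS G k)
  HasTDS? k = anySubset? λ D → (∣ D ∣ ≟ℕ k) ×-dec all? λ v → any? λ u → (u ∈? D) ×-dec adj? v u

  noIsolatedVertices⇒HasTDS : NoIsolatedVertices G → HasTDS G n
  noIsolatedVertices⇒HasTDS noIsolated = ⊤ , ∣⊤∣≡n n , λ v → proj₁ (noIsolated v) , ∈⊤ , proj₂ (noIsolated v)

cliqueCover⇒TDS : ∀ {n} (G : Graph n) → GirthAtLeast G 7 → NoIsolatedVertices G →
  ∀ k → HasCliqueCover♮2 G k → ∃[ s ] HasTDS G s × s ≤ k
cliqueCover⇒TDS {zero} G _ _ _ _ = 0 , ([] , refl , λ ()) , z≤n
cliqueCover⇒TDS {suc n} G girth noIsolated _ cover =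
  neighbourhoodPartition⇒TDS G (cliqueCover⇒neighbourhoodPartition G girth noIsolated zero cover)

theorem3p6 : ∀ {n : ℕ} (G : Graph n) → GirthAtLeast G 7 → NoIsolatedVertices G →
    Σ ℕ λ m → IsMinimum (HasCliqueCover♮2 G) m × IsMinimum (HasIMV2Partition G) m
      × IsMinimum (HasTDS G) m
theorem3p6 G girth noIsolated = m , cover-min , IMV2-min , TDS-min
  where
  TDS-min-exists : ∃ (IsMinimum (HasTDS G))
  TDS-min-exists = minimum (HasTDS? G) (noIsolatedVertices⇒HasTDS G noIsolated)
  m : ℕ
  m = proj₁ TDS-min-exists
  TDS-min : IsMinimum (HasTDS G) m
  TDS-min = proj₂ TDS-min-exists
  cover-min : IsMinimum (HasCliqueCover♮2 G) m
  cover-min = IsMinimum-transfer TDS-min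
    (neighbourhoodPartition⇒cliqueCover G (GirthAtLeast-mono G (m≤m+n 4 3) girth)
      (TDS⇒neighbourhoodPartition G (proj₁ TDS-min)))
    (cliqueCover⇒TDS G girth noIsolated)
  IMV2-min : IsMinimum (HasIMV2Partition G) m
  IMV2-min = IsMinimum-transfer cover-min (cliqueCover⇒IMV2Partition G (proj₁ cover-min))
    (λ k partition → k , IMV2Partition⇒cliqueCover G partition , ≤-refl)
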